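{- For every integer $k\ge 4$, $S_{2,2,1}\le C_k$.
   Context: All graphs are finite and simple, considered up to isomorphism. An edge-colored graph is a pair $(G,c)$ with $c\colon E(G)\to\mathbb{N}$ an arbitrary map (not necessarily proper); it is colored in $t$ or more colors if $|c(E(G))|\ge t$. A subgraph (not necessarily induced) is rainbow if its edges receive pairwise distinct colors. $(G,c)$ is rainbow $H$-free if $G$ contains no rainbow subgraph isomorphic to $H$. For graphs $H_1,H_2$, write $H_1\le H_2$ if there is a positive integer $t$ such that every rainbow $H_1$-free edge-colored complete graph colored in $t$ or more colors is rainbow $H_2$-free. $C_k$ is the cycle on $k$ vertices. For positive integers $a,b,c$, $S_{a,b,c}$ is the tree consisting of one vertex (the branch vertex) joined by three internally disjoint paths of lengths $a$, $b$, $c$ (legs); it has $a+b+c+1$ vertices. -}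

module Defs where

open import Data.Nat using (ℕ; zero; suc; _≤_)
open import Data.Fin using (Fin; zero; suc; fromℕ; inject₁)
open import Data.List using (List; []; _∷_; map; length; allFin)
open import Data.List.Relation.Unary.All using (All)
open import Data.List.Relation.Unary.Unique.Propositional using (Unique)
open import Data.Product using (_×_; _,_; Σ; ∃; ∃-syntax)
open import Relation.Binary.PropositionalEquality using (_≡_; _≢_)
open import Relation.Nullary using (¬_)
open import Function.Definitions using (Injective)

-- A finite simple graph given by a number of vertices and a list of edges
-- (each edge listed once, as an unordered pair written as an ordered pair).
record Graph : Set where
  constructor graph
  field
    order : ℕ
    edges : List (Fin order × Fin order)
open Graph public

-- An edge-colouring of the complete graph K_n on vertex set Fin n:
-- a colour c u v ∈ ℕ for each pair u ≠ v, symmetric.  (Values on the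
-- diagonal are irrelevant and never used.)
record Coloring (n : ℕ) : Set where
  constructor coloring
  field
    col : Fin n → Fin n → ℕ
    sym : ∀ u v → col u v ≡ col v u
open Coloring public

UsedColor : {n : ℕ} → Coloring n → ℕ → Set
UsedColor {n} c x = Σ (Fin n) λ u → Σ (Fin n) λ v → (u ≢ v) × (col c u v ≡ x)

ColoredInAtLeast : {n : ℕ} → Coloring n → ℕ → Set
ColoredInAtLeast c t =
  Σ (List ℕ) λ xs → (t ≤ length xs) × Unique xs × All (UsedColor c) xs

imageColors : {n : ℕ} (H : Graph) → Coloring n → (Fin (order H) → Fin n) → List ℕ
imageColors H c f = map (λ e → col c (f (Data.Product.proj₁ e)) (f (Data.Product.proj₂ e))) (edges H)

-- (K_n , c) contains a rainbow subgraph isomorphic to H: an injective map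
-- V(H) → V(K_n) (every pair of distinct vertices of K_n is an edge) such
-- that the images of the edges of H receive pairwise distinct colours.
HasRainbow : {n : ℕ} → Graph → Coloring n → Set
HasRainbow {n} H c =
  Σ (Fin (order H) → Fin n) λ f → Injective _≡_ _≡_ f × Unique (imageColors H c f)

RainbowFree : {n : ℕ} → Graph → Coloring n → Set
RainbowFree H c = ¬ HasRainbow H c

_≼_ : Graph → Graph → Set
H₁ ≼ H₂ = Σ ℕ λ t → (1 ≤ t) × (∀ (n : ℕ) (c : Coloring n) →
  ColoredInAtLeast c t → RainbowFree H₁ c → RainbowFree H₂ c)

S221 : Graph
S221 = graph 6
  ( (v0 , v1) ∷ (v1 , v2) ∷ (v0 , v3) ∷ (v3 , v4) ∷ (v0 , v5) ∷ [])
  where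
  v0 v1 v2 v3 v4 v5 : Fin 6
  v0 = zero
  v1 = suc zero
  v2 = suc (suc zero)
  v3 = suc (suc (suc zero))
  v4 = suc (suc (suc (suc zero)))
  v5 = suc (suc (suc (suc (suc zero))))

-- The cycle C_k on vertex set Fin k: edges i—(i+1) for i < k-1 and (k-1)—0.
-- (Only meaningful for k ≥ 3; the k = 0 case is a dummy.)
Cycle : ℕ → Graph
Cycle zero = graph zero []
Cycle (suc m) = graph (suc m) ((fromℕ m , zero) ∷ map (λ i → inject₁ i , suc i) (allFin m))

-- Let f be a rainbow k-cycle in a rainbow S₂,₂,₁-free colouring and Y the k² colours on pairs of
-- cycle vertices; take t = 10 + k². For k ≥ 5, an edge from a cycle vertex v to a vertex off the
-- cycle must repeat one of the four cycle colours around v, since otherwise it is the pendant of a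
-- rainbow S₂,₂,₁ whose legs run along the cycle. An edge off the cycle with a colour outside Y then
-- forces such spokes, with colours of neighbouring cycle edges, from one of its ends to the cycle
-- vertices 2 and 4 or 5, and these spokes, continued along the cycle, are the legs of a rainbow
-- S₂,₂,₁ with that edge as pendant. So every colour lies in Y.
-- For k = 4 the cycle is too short for this. Instead, three distinct fresh spoke colours at a
-- corner give a rainbow S₂,₂,₁, and so do two fresh edges off the square with different colours;
-- hence at most 16 + 4·2 + 1 colours occur.

module Submission where

open import Defs renaming (sym to col-sym)
open import Data.Empty using (⊥; ⊥-elim)
open import Data.Fin as Fin using (Fin; zero; suc; toℕ; fromℕ<; inject₁; #_)
open import Data.Fin.Properties using (any?; toℕ-fromℕ<; toℕ-fromℕ; toℕ-inject₁; toℕ-injective; toℕ<n)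
open import Data.List using (List; []; _∷_; map; length; allFin; concatMap; lookup; _++_; filter; deduplicate)
open import Data.List.Membership.Propositional using (_∈_; _∉_; _─_; lose)
open import Data.List.Membership.Propositional.Properties
  using (∈-lookup; ∈-allFin; ∈-map⁺; ∈-map⁻; ∈-concatMap⁺; ∈-++⁺ˡ; ∈-++⁺ʳ; ∈-filter⁺; ∈-filter⁻;
         ∈-deduplicate⁺; ∈-deduplicate⁻)
open import Data.List.Properties using (length-++; length-map; length-removeAt′; length-tabulate)
open import Data.List.Relation.Unary.All as All using (All; []; _∷_)
open import Data.List.Relation.Unary.AllPairs using ([]; _∷_; allPairs?)
open import Data.List.Relation.Unary.Any using (here; there)
open import Data.List.Relation.Unary.Unique.Propositional using (Unique)
open import Data.List.Relation.Unary.Unique.DecPropositional.Properties using (deduplicate-!)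
open import Data.Nat using (ℕ; zero; suc; NonZero; _+_; _*_; _∸_; _≤_; _<_; z≤n; s≤s; s≤s⁻¹; _<?_; _≤?_)
open import Data.Nat.Properties
  using (≤-trans; ≤-reflexive; ≤-antisym; ≮⇒≥; <-irrefl; n≤1+n; <⇒≤; m≤m+n; m<n⇒0<n∸m; m+n≮m;
         +-mono-≤; +-comm; +-assoc; +-cancelʳ-≡; m∸n+n≡m)
open import Data.Nat.DivMod
  using (_%_; _/_; _mod_; m≡m%n+[m/n]*n; %-distribˡ-+; m<n⇒m%n≡m; m%n<n; n%n≡0; [m+n]%n≡m%n; [m+kn]%n≡m%n)
open import Data.Product using (∃; ∃₂; _×_; _,_; proj₁; proj₂)
open import Data.Sum using (_⊎_; inj₁; inj₂)
open import Function.Definitions using (Injective)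
open import Relation.Binary.Definitions using (DecidableEquality)
open import Relation.Binary.PropositionalEquality
  using (_≡_; _≢_; refl; sym; trans; cong; cong₂; subst; ≢-sym; module ≡-Reasoning)
open import Relation.Nullary using (¬_; Dec; yes; no; contradiction)
open import Relation.Nullary.Decidable using (True; toWitness; _×-dec_; _⊎-dec_)
open import Function.Base using (_∘_)

module _ {A : Set} (_≟_ : DecidableEquality A) where
  open import Data.List.Membership.DecPropositional _≟_ using (_∈?_)

  ∈-─⁺ : ∀ {x y} {ys : List A} (x∈ys : x ∈ ys) → y ∈ ys → y ≢ x → y ∈ ys ─ x∈ys
  ∈-─⁺ (here refl) (here refl)   y≢x = contradiction refl y≢x
  ∈-─⁺ (here refl) (there y∈ys)  _   = y∈ys
  ∈-─⁺ (there _)   (here refl)   _   = here refl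
  ∈-─⁺ (there x∈ys) (there y∈ys) y≢x = there (∈-─⁺ x∈ys y∈ys y≢x)

  pigeonhole-∉ : ∀ {xs ys : List A} → Unique xs → length ys < length xs → ∃ λ x → x ∈ xs × x ∉ ys
  pigeonhole-∉ {x ∷ xs} {ys} (x∉xs ∷ xs!) |ys|≤|xs| with x ∈? ys
  ... | no x∉ys = x , here refl , x∉ys
  ... | yes x∈ys with pigeonhole-∉ xs! (subst (_≤ length xs) (length-removeAt′ ys _) (s≤s⁻¹ |ys|≤|xs|))
  ...   | y , y∈xs , y∉ys─x = y , there y∈xs , λ y∈ys → y∉ys─x (∈-─⁺ x∈ys y∈ys (≢-sym (All.lookup x∉xs y∈xs)))

lookup-injective : ∀ {A : Set} {xs : List A} → Unique xs → Injective _≡_ _≡_ (lookup xs)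
lookup-injective {xs = _ ∷ _} _           {zero}  {zero}  _  = refl
lookup-injective {xs = _ ∷ _} (x∉xs ∷ _)  {zero}  {suc j} eq = contradiction eq (All.lookup x∉xs (∈-lookup j))
lookup-injective {xs = _ ∷ _} (x∉xs ∷ _)  {suc i} {zero}  eq = contradiction (sym eq) (All.lookup x∉xs (∈-lookup i))
lookup-injective {xs = _ ∷ _} (_ ∷ xs!)   {suc i} {suc j} eq = cong suc (lookup-injective xs! eq)

unique-map-injective : ∀ {A B : Set} (F : A → B) {xs x y} → Unique (map F xs) → x ∈ xs → y ∈ xs → F x ≡ F y → x ≡ y
unique-map-injective F (_ ∷ _)     (here refl) (here refl) _   = refl
unique-map-injective F (Fx∉ ∷ _)   (here refl) (there y∈)  eq  = contradiction eq (All.lookup Fx∉ (∈-map⁺ F y∈))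
unique-map-injective F (Fy∉ ∷ _)   (there x∈)  (here refl) eq  = contradiction (sym eq) (All.lookup Fy∉ (∈-map⁺ F x∈))
unique-map-injective F (_ ∷ Fxs!)  (there x∈)  (there y∈)  eq  = unique-map-injective F Fxs! x∈ y∈ eq

length-concatMap-≤ : ∀ {A B : Set} {b} (g : A → List B) → (∀ x → length (g x) ≤ b) →
                     ∀ xs → length (concatMap g xs) ≤ length xs * b
length-concatMap-≤ g |g|≤b []       = z≤n
length-concatMap-≤ g |g|≤b (x ∷ xs) = ≤-trans (≤-reflexive (length-++ (g x)))
                                              (+-mono-≤ (|g|≤b x) (length-concatMap-≤ g |g|≤b xs))

Outside : ∀ {k n} → (Fin k → Fin n) → Fin n → Set
Outside f u = ∀ i → f i ≢ u

outside? : ∀ {k n} (f : Fin k → Fin n) u → (∃ λ i → f i ≡ u) ⊎ Outside f u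
outside? f u with any? (λ i → f i Fin.≟ u)
... | yes hit = inj₁ hit
... | no miss = inj₂ λ i fi≡u → miss (i , fi≡u)

AtMostOneColourOutside : ∀ {n} → Coloring n → List ℕ → Set
AtMostOneColourOutside c L = ∀ {x y} → UsedColor c x → UsedColor c y → x ∉ L → y ∉ L → x ≡ y

two-colours-outside : ∀ {n t} {c : Coloring n} {L : List ℕ} →
                      ColoredInAtLeast c t → 2 + length L ≤ t → ¬ AtMostOneColourOutside c L
two-colours-outside (xs , t≤|xs| , xs! , used) 2+|L|≤t one
  with 2+|L|≤|xs| ← ≤-trans 2+|L|≤t t≤|xs|
  with x , x∈xs , x∉L ← pigeonhole-∉ Data.Nat._≟_ xs! (≤-trans (n≤1+n _) 2+|L|≤|xs|)
  with y , y∈xs , y∉x∷L ← pigeonhole-∉ Data.Nat._≟_ xs! 2+|L|≤|xs|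
  = y∉x∷L (here (sym (one (All.lookup used x∈xs) (All.lookup used y∈xs) x∉L (y∉x∷L ∘ there))))

module _ {n} (c : Coloring n) where

  col-swap : ∀ {u v x} → col c u v ≡ x → col c v u ≡ x
  col-swap = trans (col-sym c _ _)

  rainbow-S221 : (b x₁ y₁ x₂ y₂ p : Fin n) {a₁ a₂ a₃ a₄ a₅ : ℕ} →
                 col c b x₁ ≡ a₁ → col c x₁ y₁ ≡ a₂ → col c b x₂ ≡ a₃ → col c x₂ y₂ ≡ a₄ → col c b p ≡ a₅ →
                 Unique (b ∷ x₁ ∷ y₁ ∷ x₂ ∷ y₂ ∷ p ∷ []) → Unique (a₁ ∷ a₂ ∷ a₃ ∷ a₄ ∷ a₅ ∷ []) →
                 HasRainbow S221 c
  rainbow-S221 b x₁ y₁ x₂ y₂ p refl refl refl refl refl vertices! colours! =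
    lookup (b ∷ x₁ ∷ y₁ ∷ x₂ ∷ y₂ ∷ p ∷ []) , lookup-injective vertices! , colours!

  module _ {k} (f : Fin k → Fin n) where

    innerColours : List ℕ
    innerColours = concatMap (λ a → map (λ b → col c (f a) (f b)) (allFin k)) (allFin k)

    ∈-innerColours : ∀ a b → col c (f a) (f b) ∈ innerColours
    ∈-innerColours a b = ∈-concatMap⁺ _ (lose (∈-allFin a) (∈-map⁺ _ (∈-allFin b)))

    ∉-innerColours : ∀ {x} → x ∉ innerColours → ∀ a b → x ≢ col c (f a) (f b)
    ∉-innerColours x∉Y a b refl = x∉Y (∈-innerColours a b)

    length-innerColours : length innerColours ≤ k * k
    length-innerColours = ≤-trans (length-concatMap-≤ _ |row|≤k (allFin k))
                                  (≤-reflexive (cong (_* k) (length-tabulate {n = k} (λ i → i))))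
      where
      |row|≤k : ∀ a → length (map (λ b → col c (f a) (f b)) (allFin k)) ≤ k
      |row|≤k a = ≤-reflexive (trans (length-map _ (allFin k)) (length-tabulate _))

    new-colour-site : ∀ {x} → UsedColor c x → x ∉ innerColours →
                      (∃₂ λ i q → Outside f q × col c (f i) q ≡ x) ⊎
                      (∃₂ λ u w → Outside f u × Outside f w × u ≢ w × col c u w ≡ x)
    new-colour-site (p , q , p≢q , pq≡x) x∉Y with outside? f p | outside? f q
    ... | inj₁ (i , refl) | inj₁ (j , refl) = contradiction pq≡x (≢-sym (∉-innerColours x∉Y i j))
    ... | inj₁ (i , refl) | inj₂ q-out      = inj₁ (i , q , q-out , pq≡x)
    ... | inj₂ p-out      | inj₁ (j , refl) = inj₁ (j , p , p-out , col-swap pq≡x)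
    ... | inj₂ p-out      | inj₂ q-out      = inj₂ (p , q , p-out , q-out , p≢q , pq≡x)

-- Cycles of length at least five

module _ {K : ℕ} .{{_ : NonZero K}} where
  open ≡-Reasoning

  %-shift-apart : ∀ r {d} → 0 < d → d < K → (d + r) % K ≢ r
  %-shift-apart r {d} 0<d d<K eq = not-multiple ((d + r) / K) (+-cancelʳ-≡ r d _ d+r≡qK+r)
    where
    d+r≡qK+r : d + r ≡ (d + r) / K * K + r
    d+r≡qK+r = begin
      d + r                          ≡⟨ m≡m%n+[m/n]*n (d + r) K ⟩
      (d + r) % K + (d + r) / K * K  ≡⟨ cong (_+ (d + r) / K * K) eq ⟩
      r + (d + r) / K * K            ≡⟨ +-comm r _ ⟩
      (d + r) / K * K + r            ∎
    not-multiple : ∀ q → d ≢ q * K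
    not-multiple zero    refl = <-irrefl refl 0<d
    not-multiple (suc q) refl = m+n≮m K (q * K) d<K

  mod-apart : ∀ i {d} → 0 < d → d < K → i mod K ≢ (d + i) mod K
  mod-apart i {d} 0<d d<K eq = %-shift-apart (i % K) 0<d d<K (sym (begin
    i % K                 ≡⟨ toℕ-fromℕ< _ ⟨
    toℕ (i mod K)         ≡⟨ cong toℕ eq ⟩
    toℕ ((d + i) mod K)   ≡⟨ toℕ-fromℕ< _ ⟩
    (d + i) % K           ≡⟨ %-distribˡ-+ d i K ⟩
    (d % K + i % K) % K   ≡⟨ cong (λ x → (x + i % K) % K) (m<n⇒m%n≡m d<K) ⟩
    (d + i % K) % K       ∎))

  suc-% : ∀ i → suc i % K ≡ suc (i % K) % K
  suc-% i = begin
    suc i % K                     ≡⟨ cong (λ x → suc x % K) (m≡m%n+[m/n]*n i K) ⟩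
    (suc (i % K) + i / K * K) % K ≡⟨ [m+kn]%n≡m%n (suc (i % K)) (i / K) K ⟩
    suc (i % K) % K               ∎

mod-step-edge : ∀ {m} i → (i mod suc m , suc i mod suc m) ∈ edges (Cycle (suc m))
mod-step-edge {m} i with i % suc m <? m
... | yes r<m = there (subst (_∈ _) (sym same-edge) (∈-map⁺ _ (∈-allFin r)))
  where
  open ≡-Reasoning
  r : Fin m
  r = fromℕ< r<m
  same-edge : (i mod suc m , suc i mod suc m) ≡ (inject₁ r , suc r)
  same-edge = cong₂ _,_
    (toℕ-injective (trans (toℕ-fromℕ< _) (sym (trans (toℕ-inject₁ r) (toℕ-fromℕ< r<m)))))
    (toℕ-injective (begin
      toℕ (suc i mod suc m)   ≡⟨ toℕ-fromℕ< _ ⟩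
      suc i % suc m           ≡⟨ suc-% {suc m} i ⟩
      suc (i % suc m) % suc m ≡⟨ m<n⇒m%n≡m (s≤s r<m) ⟩
      suc (i % suc m)         ≡⟨ cong suc (toℕ-fromℕ< r<m) ⟨
      toℕ (suc r)             ∎))
... | no r≮m = here (cong₂ _,_
    (toℕ-injective (trans (toℕ-fromℕ< _) (trans r≡m (sym (toℕ-fromℕ m)))))
    (toℕ-injective (trans (toℕ-fromℕ< _)
      (trans (suc-% {suc m} i) (trans (cong (λ x → suc x % suc m) r≡m) (n%n≡0 (suc m)))))))
  where
  r≡m : i % suc m ≡ m
  r≡m = ≤-antisym (s≤s⁻¹ (m%n<n i (suc m))) (≮⇒≥ r≮m)

Near : ℕ → ℕ → Set
Near a b = (a < b × b ∸ a ≤ 4) ⊎ (b < a × a ∸ b ≤ 4)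

near? : ∀ a b → Dec (Near a b)
near? a b = (a <? b ×-dec b ∸ a ≤? 4) ⊎-dec (b <? a ×-dec a ∸ b ≤? 4)

near-apart : ∀ {X : Set} (F : ℕ → X) → (∀ i {d} → 0 < d → d ≤ 4 → F i ≢ F (d + i)) →
             ∀ {a b} → Near a b → ∀ j → F (a + j) ≢ F (b + j)
near-apart F apart (inj₁ (a<b , b∸a≤4)) j = ordered a<b b∸a≤4 j
  where
  ordered : ∀ {a b} → a < b → b ∸ a ≤ 4 → ∀ j → F (a + j) ≢ F (b + j)
  ordered {a} {b} a<b b∸a≤4 j = subst (λ x → F (a + j) ≢ F x)
    (trans (sym (+-assoc (b ∸ a) a j)) (cong (_+ j) (m∸n+n≡m (<⇒≤ a<b))))
    (apart (a + j) (m<n⇒0<n∸m a<b) b∸a≤4)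
near-apart F apart (inj₂ (b<a , a∸b≤4)) j = ≢-sym (near-apart F apart (inj₁ (b<a , a∸b≤4)) j)

module LongCycle {n} (c : Coloring n) (S221-free : RainbowFree S221 c) (m : ℕ)
                 (f : Fin (5 + m) → Fin n) (f-injective : Injective _≡_ _≡_ f)
                 (f-rainbow : Unique (imageColors (Cycle (5 + m)) c f)) where

  open ≡-Reasoning
  open import Data.List.Membership.DecPropositional Data.Nat._≟_ using (_∈?_)

  K : ℕ
  K = 5 + m

  -- The cycle unrolled along ℕ. Positions are written a + j with a a numeral, so that
  -- h (a + j) is definitionally the colour between g (a + j) and g (suc a + j).
  g : ℕ → Fin n
  g i = f (i mod K)

  h : ℕ → ℕ
  h i = col c (g i) (g (suc i))

  ≤4⇒<K : ∀ {d} → d ≤ 4 → d < K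
  ≤4⇒<K d≤4 = s≤s (≤-trans d≤4 (m≤m+n 4 m))

  g-apart : ∀ i {d} → 0 < d → d ≤ 4 → g i ≢ g (d + i)
  g-apart i 0<d d≤4 = mod-apart i 0<d (≤4⇒<K d≤4) ∘ f-injective

  h-apart : ∀ i {d} → 0 < d → d ≤ 4 → h i ≢ h (d + i)
  h-apart i {d} 0<d d≤4 = mod-apart i 0<d (≤4⇒<K d≤4) ∘ cong proj₁ ∘
    unique-map-injective (λ e → col c (f (proj₁ e)) (f (proj₂ e))) f-rainbow (mod-step-edge i) (mod-step-edge (d + i))

  -- For numerals a and b the proof of Near a b is found by evaluation.
  g≢ : ∀ a b {near : True (near? a b)} j → g (a + j) ≢ g (b + j)
  g≢ a b {near} = near-apart g g-apart (toWitness near)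

  h≢ : ∀ a b {near : True (near? a b)} j → h (a + j) ≢ h (b + j)
  h≢ a b {near} = near-apart h h-apart (toWitness near)

  Y : List ℕ
  Y = innerColours c f

  h∈Y : ∀ i → h i ∈ Y
  h∈Y i = ∈-innerColours c f (i mod K) (suc i mod K)

  ∉Y⇒≢h : ∀ {x} → x ∉ Y → ∀ i → x ≢ h i
  ∉Y⇒≢h x∉Y i = ∉-innerColours c f x∉Y (i mod K) (suc i mod K)

  window : ℕ → List ℕ
  window j = h j ∷ h (1 + j) ∷ h (2 + j) ∷ h (3 + j) ∷ []

  window⊆Y : ∀ j {x} → x ∈ window j → x ∈ Y
  window⊆Y j (here refl)                         = h∈Y j
  window⊆Y j (there (here refl))                 = h∈Y (1 + j)
  window⊆Y j (there (there (here refl)))         = h∈Y (2 + j)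
  window⊆Y j (there (there (there (here refl)))) = h∈Y (3 + j)

  spoke-in-window : ∀ j {u} → Outside f u → col c (g (2 + j)) u ∈ window j
  spoke-in-window j {u} u-out with col c (g (2 + j)) u ∈? window j
  ... | yes x∈ = x∈
  ... | no x∉ = contradiction
      (rainbow-S221 c (g (2 + j)) (g (3 + j)) (g (4 + j)) (g (1 + j)) (g j) u
         refl refl (col-sym c _ _) (col-sym c _ _) refl
         ((g≢ 2 3 j ∷ g≢ 2 4 j ∷ g≢ 2 1 j ∷ g≢ 2 0 j ∷ u-out _ ∷ []) ∷
          (g≢ 3 4 j ∷ g≢ 3 1 j ∷ g≢ 3 0 j ∷ u-out _ ∷ []) ∷
          (g≢ 4 1 j ∷ g≢ 4 0 j ∷ u-out _ ∷ []) ∷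
          (g≢ 1 0 j ∷ u-out _ ∷ []) ∷
          (u-out _ ∷ []) ∷ [] ∷ [])
         ((h≢ 2 3 j ∷ h≢ 2 1 j ∷ h≢ 2 0 j ∷ ≢-sym (x∉ ∘ there ∘ there ∘ here) ∷ []) ∷
          (h≢ 3 1 j ∷ h≢ 3 0 j ∷ ≢-sym (x∉ ∘ there ∘ there ∘ there ∘ here) ∷ []) ∷
          (h≢ 1 0 j ∷ ≢-sym (x∉ ∘ there ∘ here) ∷ []) ∷
          (≢-sym (x∉ ∘ here) ∷ []) ∷
          [] ∷ []))
      S221-free

  spoke-beside-fresh-edge : ∀ j {u w} → Outside f u → Outside f w → u ≢ w → col c u w ∉ Y →
                            col c (g (2 + j)) u ≡ h (1 + j) ⊎ col c (g (2 + j)) u ≡ h (2 + j)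
  spoke-beside-fresh-edge j {u} {w} u-out w-out u≢w x∉Y with spoke-in-window j u-out
  ... | there (here e)         = inj₁ e
  ... | there (there (here e)) = inj₂ e
  ... | here e = contradiction
      (rainbow-S221 c (g (2 + j)) u w (g (3 + j)) (g (4 + j)) (g (1 + j))
         e refl refl refl (col-sym c _ _)
         ((u-out _ ∷ w-out _ ∷ g≢ 2 3 j ∷ g≢ 2 4 j ∷ g≢ 2 1 j ∷ []) ∷
          (u≢w ∷ ≢-sym (u-out _) ∷ ≢-sym (u-out _) ∷ ≢-sym (u-out _) ∷ []) ∷
          (≢-sym (w-out _) ∷ ≢-sym (w-out _) ∷ ≢-sym (w-out _) ∷ []) ∷
          (g≢ 3 4 j ∷ g≢ 3 1 j ∷ []) ∷
          (g≢ 4 1 j ∷ []) ∷ [] ∷ [])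
         ((≢-sym (x≢h j) ∷ h≢ 0 2 j ∷ h≢ 0 3 j ∷ h≢ 0 1 j ∷ []) ∷
          (x≢h (2 + j) ∷ x≢h (3 + j) ∷ x≢h (1 + j) ∷ []) ∷
          (h≢ 2 3 j ∷ h≢ 2 1 j ∷ []) ∷
          (h≢ 3 1 j ∷ []) ∷ [] ∷ []))
      S221-free
    where
    x≢h : ∀ i → col c u w ≢ h i
    x≢h = ∉Y⇒≢h x∉Y
  ... | there (there (there (here e))) = contradiction
      (rainbow-S221 c (g (2 + j)) u w (g (1 + j)) (g j) (g (3 + j))
         e refl (col-sym c _ _) (col-sym c _ _) refl
         ((u-out _ ∷ w-out _ ∷ g≢ 2 1 j ∷ g≢ 2 0 j ∷ g≢ 2 3 j ∷ []) ∷
          (u≢w ∷ ≢-sym (u-out _) ∷ ≢-sym (u-out _) ∷ ≢-sym (u-out _) ∷ []) ∷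
          (≢-sym (w-out _) ∷ ≢-sym (w-out _) ∷ ≢-sym (w-out _) ∷ []) ∷
          (g≢ 1 0 j ∷ g≢ 1 3 j ∷ []) ∷
          (g≢ 0 3 j ∷ []) ∷ [] ∷ [])
         ((≢-sym (x≢h (3 + j)) ∷ h≢ 3 1 j ∷ h≢ 3 0 j ∷ h≢ 3 2 j ∷ []) ∷
          (x≢h (1 + j) ∷ x≢h j ∷ x≢h (2 + j) ∷ []) ∷
          (h≢ 1 0 j ∷ h≢ 1 2 j ∷ []) ∷
          (h≢ 0 2 j ∷ []) ∷ [] ∷ []))
      S221-free
    where
    x≢h : ∀ i → col c u w ≢ h i
    x≢h = ∉Y⇒≢h x∉Y

  fresh-edge-and-two-legs : ∀ {u w} → Outside f u → Outside f w → u ≢ w → col c u w ∉ Y →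
    ∀ j a a' b b' α β γ δ
      {positions : True (allPairs? near? (a ∷ a' ∷ b ∷ b' ∷ []))}
      {colours : True (allPairs? near? (α ∷ β ∷ γ ∷ δ ∷ []))} →
    col c u (g (a + j)) ≡ h (α + j) → col c (g (a + j)) (g (a' + j)) ≡ h (β + j) →
    col c u (g (b + j)) ≡ h (γ + j) → col c (g (b + j)) (g (b' + j)) ≡ h (δ + j) → ⊥
  fresh-edge-and-two-legs {u} {w} u-out w-out u≢w x∉Y j a a' b b' α β γ δ {positions} {colours} e₁ e₂ e₃ e₄
    with (aa' ∷ ab ∷ ab' ∷ []) ∷ (a'b ∷ a'b' ∷ []) ∷ (bb' ∷ []) ∷ _ ← toWitness positions
       | (αβ ∷ αγ ∷ αδ ∷ []) ∷ (βγ ∷ βδ ∷ []) ∷ (γδ ∷ []) ∷ _ ← toWitness colours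
    = S221-free (rainbow-S221 c _ _ _ _ _ _ e₁ e₂ e₃ e₄ refl
        ((≢-sym (u-out _) ∷ ≢-sym (u-out _) ∷ ≢-sym (u-out _) ∷ ≢-sym (u-out _) ∷ u≢w ∷ []) ∷
         (near-apart g g-apart aa' j ∷ near-apart g g-apart ab j ∷ near-apart g g-apart ab' j ∷ w-out _ ∷ []) ∷
         (near-apart g g-apart a'b j ∷ near-apart g g-apart a'b' j ∷ w-out _ ∷ []) ∷
         (near-apart g g-apart bb' j ∷ w-out _ ∷ []) ∷
         (w-out _ ∷ []) ∷ [] ∷ [])
        ((near-apart h h-apart αβ j ∷ near-apart h h-apart αγ j ∷ near-apart h h-apart αδ j ∷ x≢h α ∷ []) ∷
         (near-apart h h-apart βγ j ∷ near-apart h h-apart βδ j ∷ x≢h β ∷ []) ∷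
         (near-apart h h-apart γδ j ∷ x≢h γ ∷ []) ∷
         (x≢h δ ∷ []) ∷ [] ∷ []))
    where
    x≢h : ∀ a → h (a + j) ≢ col c u w
    x≢h a = ≢-sym (∉Y⇒≢h x∉Y (a + j))

  fresh-outer-edge-impossible : ∀ {u w} → Outside f u → Outside f w → u ≢ w → col c u w ∉ Y → ⊥
  fresh-outer-edge-impossible {u} u-out w-out u≢w x∉Y =
    two-legs (spoke-beside-fresh-edge 0 u-out w-out u≢w x∉Y)
             (spoke-beside-fresh-edge 2 u-out w-out u≢w x∉Y)
             (spoke-beside-fresh-edge 3 u-out w-out u≢w x∉Y)
    where
    two-legs : col c (g 2) u ≡ h 1 ⊎ col c (g 2) u ≡ h 2 → col c (g 4) u ≡ h 3 ⊎ col c (g 4) u ≡ h 4 →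
               col c (g 5) u ≡ h 4 ⊎ col c (g 5) u ≡ h 5 → ⊥
    two-legs (inj₁ e₂) _         (inj₁ e₅) = fresh-edge-and-two-legs u-out w-out u≢w x∉Y 0 2 3 5 6 1 2 4 5
                                               (col-swap c e₂) refl (col-swap c e₅) refl
    two-legs (inj₁ e₂) _         (inj₂ e₅) = fresh-edge-and-two-legs u-out w-out u≢w x∉Y 0 2 3 5 4 1 2 5 4
                                               (col-swap c e₂) refl (col-swap c e₅) (col-sym c _ _)
    two-legs (inj₂ e₂) (inj₁ e₄) _         = fresh-edge-and-two-legs u-out w-out u≢w x∉Y 0 2 1 4 5 2 1 3 4
                                               (col-swap c e₂) (col-sym c _ _) (col-swap c e₄) refl
    two-legs (inj₂ e₂) (inj₂ e₄) _         = fresh-edge-and-two-legs u-out w-out u≢w x∉Y 0 2 1 4 3 2 1 4 3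
                                               (col-swap c e₂) (col-sym c _ _) (col-swap c e₄) (col-sym c _ _)

  centre : ∀ i → g (2 + (3 + m + toℕ i)) ≡ f i
  centre i = cong f (toℕ-injective (begin
    toℕ ((K + toℕ i) mod K)  ≡⟨ toℕ-fromℕ< _ ⟩
    (K + toℕ i) % K          ≡⟨ cong (_% K) (+-comm K (toℕ i)) ⟩
    (toℕ i + K) % K          ≡⟨ [m+n]%n≡m%n (toℕ i) K ⟩
    toℕ i % K                ≡⟨ m<n⇒m%n≡m (toℕ<n i) ⟩
    toℕ i                    ∎))

  spoke-colour-inner : ∀ {q} → Outside f q → ∀ i → col c (f i) q ∈ Y
  spoke-colour-inner {q} q-out i =
    subst (λ v → col c v q ∈ Y) (centre i) (window⊆Y (3 + m + toℕ i) (spoke-in-window (3 + m + toℕ i) q-out))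

  used-colours-inner : ∀ {x} → UsedColor c x → x ∈ Y
  used-colours-inner {x} used with x ∈? Y
  ... | yes x∈Y = x∈Y
  ... | no x∉Y with new-colour-site c f used x∉Y
  ...   | inj₁ (i , q , q-out , refl)                = spoke-colour-inner q-out i
  ...   | inj₂ (u , w , u-out , w-out , u≢w , refl) = ⊥-elim (fresh-outer-edge-impossible u-out w-out u≢w x∉Y)

-- Cycles of length four

next : Fin 4 → Fin 4
next zero                   = suc zero
next (suc zero)             = suc (suc zero)
next (suc (suc zero))       = suc (suc (suc zero))
next (suc (suc (suc zero))) = zero

next-apart₁ : ∀ i → i ≢ next i
next-apart₁ zero                   ()
next-apart₁ (suc zero)             ()
next-apart₁ (suc (suc zero))       ()
next-apart₁ (suc (suc (suc zero))) ()

next-apart₂ : ∀ i → i ≢ next (next i)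
next-apart₂ zero                   ()
next-apart₂ (suc zero)             ()
next-apart₂ (suc (suc zero))       ()
next-apart₂ (suc (suc (suc zero))) ()

side-edge : ∀ i → (i , next i) ∈ edges (Cycle 4)
side-edge zero                   = there (here refl)
side-edge (suc zero)             = there (there (here refl))
side-edge (suc (suc zero))       = there (there (there (here refl)))
side-edge (suc (suc (suc zero))) = here refl

module Squares {n} (c : Coloring n) where

  -- Only the pairs (i, next i) and (i, next (next i)) are kept apart; these cover all pairs, and in
  -- this form rotations preserve the record definitionally.
  record RainbowSquare : Set where
    field
      vertex        : Fin 4 → Fin n
      vertex-apart₁ : ∀ i → vertex i ≢ vertex (next i)
      vertex-apart₂ : ∀ i → vertex i ≢ vertex (next (next i))
      side-apart₁   : ∀ i → col c (vertex i) (vertex (next i)) ≢ col c (vertex (next i)) (vertex (next (next i)))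
      side-apart₂   : ∀ i → col c (vertex i) (vertex (next i)) ≢
                            col c (vertex (next (next i))) (vertex (next (next (next i))))

  open RainbowSquare public

  side : RainbowSquare → Fin 4 → ℕ
  side Z i = col c (vertex Z i) (vertex Z (next i))

  Fresh : RainbowSquare → ℕ → Set
  Fresh Z x = ∀ i → x ≢ side Z i

  rotate : RainbowSquare → RainbowSquare
  rotate Z = record
    { vertex        = vertex Z ∘ next
    ; vertex-apart₁ = vertex-apart₁ Z ∘ next
    ; vertex-apart₂ = vertex-apart₂ Z ∘ next
    ; side-apart₁   = side-apart₁ Z ∘ next
    ; side-apart₂   = side-apart₂ Z ∘ next
    }

  rotate-by : ℕ → RainbowSquare → RainbowSquare
  rotate-by zero    Z = Z
  rotate-by (suc k) Z = rotate (rotate-by k Z)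

  rotate-by-outside : ∀ k Z {u} → Outside (vertex Z) u → Outside (vertex (rotate-by k Z)) u
  rotate-by-outside zero    Z u-out = u-out
  rotate-by-outside (suc k) Z u-out = rotate-by-outside k Z u-out ∘ next

  rotate-by-fresh : ∀ k Z {x} → Fresh Z x → Fresh (rotate-by k Z) x
  rotate-by-fresh zero    Z x-fresh = x-fresh
  rotate-by-fresh (suc k) Z x-fresh = rotate-by-fresh k Z x-fresh ∘ next

  fresh-swap : ∀ Z {u w} → Fresh Z (col c u w) → Fresh Z (col c w u)
  fresh-swap Z {u} {w} uw-fresh i = uw-fresh i ∘ trans (col-sym c u w)

  module SquareFacts (S221-free : RainbowFree S221 c) (Z : RainbowSquare) where
    open import Data.List.Membership.DecPropositional Data.Nat._≟_ using (_∈?_)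

    Off : Fin n → Set
    Off = Outside (vertex Z)

    v₀ v₁ v₂ v₃ : Fin n
    v₀ = vertex Z (# 0)
    v₁ = vertex Z (# 1)
    v₂ = vertex Z (# 2)
    v₃ = vertex Z (# 3)

    c₀ c₁ c₂ c₃ : ℕ
    c₀ = side Z (# 0)
    c₁ = side Z (# 1)
    c₂ = side Z (# 2)
    c₃ = side Z (# 3)

    v₀≢v₁ : v₀ ≢ v₁
    v₀≢v₁ = vertex-apart₁ Z (# 0)
    v₁≢v₂ : v₁ ≢ v₂
    v₁≢v₂ = vertex-apart₁ Z (# 1)
    v₂≢v₃ : v₂ ≢ v₃
    v₂≢v₃ = vertex-apart₁ Z (# 2)
    v₃≢v₀ : v₃ ≢ v₀
    v₃≢v₀ = vertex-apart₁ Z (# 3)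
    v₀≢v₂ : v₀ ≢ v₂
    v₀≢v₂ = vertex-apart₂ Z (# 0)
    v₁≢v₃ : v₁ ≢ v₃
    v₁≢v₃ = vertex-apart₂ Z (# 1)

    c₀≢c₁ : c₀ ≢ c₁
    c₀≢c₁ = side-apart₁ Z (# 0)
    c₁≢c₂ : c₁ ≢ c₂
    c₁≢c₂ = side-apart₁ Z (# 1)
    c₂≢c₃ : c₂ ≢ c₃
    c₂≢c₃ = side-apart₁ Z (# 2)
    c₃≢c₀ : c₃ ≢ c₀
    c₃≢c₀ = side-apart₁ Z (# 3)
    c₀≢c₂ : c₀ ≢ c₂
    c₀≢c₂ = side-apart₂ Z (# 0)
    c₁≢c₃ : c₁ ≢ c₃
    c₁≢c₃ = side-apart₂ Z (# 1)

    branch-v₀-along-v₁ : ∀ {x y p a b d} → Off x → Off y → x ≢ y →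
                         v₀ ≢ p → v₁ ≢ p → v₂ ≢ p → x ≢ p → y ≢ p →
                         col c v₀ x ≡ a → col c x y ≡ b → col c v₀ p ≡ d →
                         Unique (a ∷ b ∷ c₀ ∷ c₁ ∷ d ∷ []) → ⊥
    branch-v₀-along-v₁ x-out y-out x≢y v₀≢p v₁≢p v₂≢p x≢p y≢p ea eb ed colours! = S221-free
      (rainbow-S221 c v₀ _ _ v₁ v₂ _ ea eb refl refl ed
        ((x-out _ ∷ y-out _ ∷ v₀≢v₁ ∷ v₀≢v₂ ∷ v₀≢p ∷ []) ∷
         (x≢y ∷ ≢-sym (x-out _) ∷ ≢-sym (x-out _) ∷ x≢p ∷ []) ∷
         (≢-sym (y-out _) ∷ ≢-sym (y-out _) ∷ y≢p ∷ []) ∷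
         (v₁≢v₂ ∷ v₁≢p ∷ []) ∷
         (v₂≢p ∷ []) ∷ [] ∷ [])
        colours!)

    branch-v₀-along-v₃ : ∀ {x y p a b d} → Off x → Off y → x ≢ y →
                         v₀ ≢ p → v₃ ≢ p → v₂ ≢ p → x ≢ p → y ≢ p →
                         col c v₀ x ≡ a → col c x y ≡ b → col c v₀ p ≡ d →
                         Unique (a ∷ b ∷ c₃ ∷ c₂ ∷ d ∷ []) → ⊥
    branch-v₀-along-v₃ x-out y-out x≢y v₀≢p v₃≢p v₂≢p x≢p y≢p ea eb ed colours! = S221-free
      (rainbow-S221 c v₀ _ _ v₃ v₂ _ ea eb (col-sym c _ _) (col-sym c _ _) ed
        ((x-out _ ∷ y-out _ ∷ ≢-sym v₃≢v₀ ∷ v₀≢v₂ ∷ v₀≢p ∷ []) ∷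
         (x≢y ∷ ≢-sym (x-out _) ∷ ≢-sym (x-out _) ∷ x≢p ∷ []) ∷
         (≢-sym (y-out _) ∷ ≢-sym (y-out _) ∷ y≢p ∷ []) ∷
         (≢-sym v₂≢v₃ ∷ v₃≢p ∷ []) ∷
         (v₂≢p ∷ []) ∷ [] ∷ [])
        colours!)

    branch-off-along-v₁ : ∀ {u x y p a b d e} → Off u → Off x → Off p →
                          u ≢ x → u ≢ y → u ≢ p → v₀ ≢ y → v₁ ≢ y → x ≢ y → x ≢ p → y ≢ p →
                          col c u v₀ ≡ a → col c u x ≡ b → col c x y ≡ d → col c u p ≡ e →
                          Unique (a ∷ c₀ ∷ b ∷ d ∷ e ∷ []) → ⊥
    branch-off-along-v₁ u-out x-out p-out u≢x u≢y u≢p v₀≢y v₁≢y x≢y x≢p y≢p ea eb ed ee colours! = S221-free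
      (rainbow-S221 c _ v₀ v₁ _ _ _ ea refl eb ed ee
        ((≢-sym (u-out _) ∷ ≢-sym (u-out _) ∷ u≢x ∷ u≢y ∷ u≢p ∷ []) ∷
         (v₀≢v₁ ∷ x-out _ ∷ v₀≢y ∷ p-out _ ∷ []) ∷
         (x-out _ ∷ v₁≢y ∷ p-out _ ∷ []) ∷
         (x≢y ∷ x≢p ∷ []) ∷
         (y≢p ∷ []) ∷ [] ∷ [])
        colours!)

    branch-off-along-v₃ : ∀ {u x y p a b d e} → Off u → Off x → Off p →
                          u ≢ x → u ≢ y → u ≢ p → v₀ ≢ y → v₃ ≢ y → x ≢ y → x ≢ p → y ≢ p →
                          col c u v₀ ≡ a → col c u x ≡ b → col c x y ≡ d → col c u p ≡ e →
                          Unique (a ∷ c₃ ∷ b ∷ d ∷ e ∷ []) → ⊥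
    branch-off-along-v₃ u-out x-out p-out u≢x u≢y u≢p v₀≢y v₃≢y x≢y x≢p y≢p ea eb ed ee colours! = S221-free
      (rainbow-S221 c _ v₀ v₃ _ _ _ ea (col-sym c _ _) eb ed ee
        ((≢-sym (u-out _) ∷ ≢-sym (u-out _) ∷ u≢x ∷ u≢y ∷ u≢p ∷ []) ∷
         (≢-sym v₃≢v₀ ∷ x-out _ ∷ v₀≢y ∷ p-out _ ∷ []) ∷
         (x-out _ ∷ v₃≢y ∷ p-out _ ∷ []) ∷
         (x≢y ∷ x≢p ∷ []) ∷
         (y≢p ∷ []) ∷ [] ∷ [])
        colours!)

    two-step-from-v₀ : ∀ {u w} → Off u → Off w → u ≢ w →
               col c v₀ u ≢ col c u w → col c v₀ u ≢ c₀ → col c v₀ u ≢ c₃ → col c u w ≢ c₀ → col c u w ≢ c₃ →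
               (col c v₀ u ≢ c₁ × col c u w ≢ c₁) ⊎ (col c v₀ u ≢ c₂ × col c u w ≢ c₂) → ⊥
    two-step-from-v₀ u-out w-out u≢w a≢b a≢c₀ a≢c₃ b≢c₀ b≢c₃ (inj₁ (a≢c₁ , b≢c₁)) =
      branch-v₀-along-v₁ u-out w-out u≢w (≢-sym v₃≢v₀) v₁≢v₃ v₂≢v₃ (≢-sym (u-out _)) (≢-sym (w-out _))
        refl refl (col-sym c _ _)
        ((a≢b ∷ a≢c₀ ∷ a≢c₁ ∷ a≢c₃ ∷ []) ∷ (b≢c₀ ∷ b≢c₁ ∷ b≢c₃ ∷ []) ∷ (c₀≢c₁ ∷ ≢-sym c₃≢c₀ ∷ []) ∷
         (c₁≢c₃ ∷ []) ∷ [] ∷ [])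
    two-step-from-v₀ u-out w-out u≢w a≢b a≢c₀ a≢c₃ b≢c₀ b≢c₃ (inj₂ (a≢c₂ , b≢c₂)) =
      branch-v₀-along-v₃ u-out w-out u≢w v₀≢v₁ (≢-sym v₁≢v₃) (≢-sym v₁≢v₂) (≢-sym (u-out _)) (≢-sym (w-out _))
        refl refl refl
        ((a≢b ∷ a≢c₃ ∷ a≢c₂ ∷ a≢c₀ ∷ []) ∷ (b≢c₃ ∷ b≢c₂ ∷ b≢c₀ ∷ []) ∷ (≢-sym c₂≢c₃ ∷ c₃≢c₀ ∷ []) ∷
         (≢-sym c₀≢c₂ ∷ []) ∷ [] ∷ [])

    spoke-to-fresh-edge : ∀ {u w} → Off u → Off w → u ≢ w → Fresh Z (col c u w) →
                          col c v₀ u ∈ c₃ ∷ c₀ ∷ col c u w ∷ []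
    spoke-to-fresh-edge {u} {w} u-out w-out u≢w b-fresh with col c v₀ u ∈? c₃ ∷ c₀ ∷ col c u w ∷ []
    ... | yes a∈ = a∈
    ... | no a∉ = ⊥-elim (two-step-from-v₀ u-out w-out u≢w (a∉ ∘ there ∘ there ∘ here) (a∉ ∘ there ∘ here) (a∉ ∘ here)
                                   (b-fresh (# 0)) (b-fresh (# 3)) avoided-side)
      where
      avoided-side : (col c v₀ u ≢ c₁ × col c u w ≢ c₁) ⊎ (col c v₀ u ≢ c₂ × col c u w ≢ c₂)
      avoided-side with col c v₀ u Data.Nat.≟ c₁
      ... | yes a≡c₁ = inj₂ (c₁≢c₂ ∘ trans (sym a≡c₁) , b-fresh (# 2))
      ... | no a≢c₁  = inj₁ (a≢c₁ , b-fresh (# 1))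

    edge-from-fresh-spoke : ∀ {u w} → Off u → Off w → u ≢ w → Fresh Z (col c v₀ u) →
                            col c u w ∈ c₀ ∷ c₃ ∷ col c v₀ u ∷ []
    edge-from-fresh-spoke {u} {w} u-out w-out u≢w a-fresh with col c u w ∈? c₀ ∷ c₃ ∷ col c v₀ u ∷ []
    ... | yes b∈ = b∈
    ... | no b∉ = ⊥-elim (two-step-from-v₀ u-out w-out u≢w (≢-sym (b∉ ∘ there ∘ there ∘ here)) (a-fresh (# 0)) (a-fresh (# 3))
                                   (b∉ ∘ here) (b∉ ∘ there ∘ here) avoided-side)
      where
      avoided-side : (col c v₀ u ≢ c₁ × col c u w ≢ c₁) ⊎ (col c v₀ u ≢ c₂ × col c u w ≢ c₂)
      avoided-side with col c u w Data.Nat.≟ c₁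
      ... | yes b≡c₁ = inj₂ (a-fresh (# 2) , c₁≢c₂ ∘ trans (sym b≡c₁))
      ... | no b≢c₁  = inj₁ (a-fresh (# 1) , b≢c₁)

    apart-by-spokes : ∀ {u w} → col c v₀ u ≢ col c v₀ w → u ≢ w
    apart-by-spokes spokes-apart = spokes-apart ∘ cong (col c v₀)

    three-fresh-spokes : ∀ {u₁ u₂ u₃} → Off u₁ → Off u₂ → Off u₃ →
                         Fresh Z (col c v₀ u₁) → Fresh Z (col c v₀ u₂) → Fresh Z (col c v₀ u₃) →
                         Unique (col c v₀ u₁ ∷ col c v₀ u₂ ∷ col c v₀ u₃ ∷ []) → ⊥
    three-fresh-spokes out₁ out₂ out₃ fresh₁ fresh₂ fresh₃ ((b₁≢b₂ ∷ b₁≢b₃ ∷ []) ∷ (b₂≢b₃ ∷ []) ∷ [] ∷ [])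
      with edge-from-fresh-spoke out₁ out₂ (apart-by-spokes b₁≢b₂) fresh₁
    ... | here e =
      branch-v₀-along-v₃ out₁ out₂ (apart-by-spokes b₁≢b₂) (out₃ _) (out₃ _) (out₃ _)
        (apart-by-spokes b₁≢b₃) (apart-by-spokes b₂≢b₃) refl e refl
        ((fresh₁ (# 0) ∷ fresh₁ (# 3) ∷ fresh₁ (# 2) ∷ b₁≢b₃ ∷ []) ∷
         (≢-sym c₃≢c₀ ∷ c₀≢c₂ ∷ ≢-sym (fresh₃ (# 0)) ∷ []) ∷
         (≢-sym c₂≢c₃ ∷ ≢-sym (fresh₃ (# 3)) ∷ []) ∷
         (≢-sym (fresh₃ (# 2)) ∷ []) ∷ [] ∷ [])
    ... | there (here e) =
      branch-v₀-along-v₁ out₁ out₂ (apart-by-spokes b₁≢b₂) (out₃ _) (out₃ _) (out₃ _)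
        (apart-by-spokes b₁≢b₃) (apart-by-spokes b₂≢b₃) refl e refl
        ((fresh₁ (# 3) ∷ fresh₁ (# 0) ∷ fresh₁ (# 1) ∷ b₁≢b₃ ∷ []) ∷
         (c₃≢c₀ ∷ ≢-sym c₁≢c₃ ∷ ≢-sym (fresh₃ (# 3)) ∷ []) ∷
         (c₀≢c₁ ∷ ≢-sym (fresh₃ (# 0)) ∷ []) ∷
         (≢-sym (fresh₃ (# 1)) ∷ []) ∷ [] ∷ [])
    ... | there (there (here e)) =
      branch-v₀-along-v₁ out₂ out₁ (apart-by-spokes (≢-sym b₁≢b₂)) (out₃ _) (out₃ _) (out₃ _)
        (apart-by-spokes b₂≢b₃) (apart-by-spokes b₁≢b₃) refl (col-swap c e) refl
        ((≢-sym b₁≢b₂ ∷ fresh₂ (# 0) ∷ fresh₂ (# 1) ∷ b₂≢b₃ ∷ []) ∷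
         (fresh₁ (# 0) ∷ fresh₁ (# 1) ∷ b₁≢b₃ ∷ []) ∷
         (c₀≢c₁ ∷ ≢-sym (fresh₃ (# 0)) ∷ []) ∷
         (≢-sym (fresh₃ (# 1)) ∷ []) ∷ [] ∷ [])

    fresh-spoke-colours : ∀ (L : List ℕ) → Unique L →
                          (∀ {x} → x ∈ L → Fresh Z x × ∃ λ u → Off u × col c v₀ u ≡ x) → length L ≤ 2
    fresh-spoke-colours []                _ _ = z≤n
    fresh-spoke-colours (_ ∷ [])          _ _ = s≤s z≤n
    fresh-spoke-colours (_ ∷ _ ∷ [])      _ _ = s≤s (s≤s z≤n)
    fresh-spoke-colours (_ ∷ _ ∷ _ ∷ _) ((x₁≢x₂ ∷ x₁≢x₃ ∷ _) ∷ (x₂≢x₃ ∷ _) ∷ _) spoke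
      with spoke (here refl) | spoke (there (here refl)) | spoke (there (there (here refl)))
    ... | fresh₁ , _ , out₁ , refl | fresh₂ , _ , out₂ , refl | fresh₃ , _ , out₃ , refl =
      ⊥-elim (three-fresh-spokes out₁ out₂ out₃ fresh₁ fresh₂ fresh₃ ((x₁≢x₂ ∷ x₁≢x₃ ∷ []) ∷ (x₂≢x₃ ∷ []) ∷ [] ∷ []))

    spoke-between-fresh-edges : ∀ {u w w'} → Off u → Off w → Off w' → u ≢ w → u ≢ w' →
                                Fresh Z (col c u w) → Fresh Z (col c u w') → col c u w ≢ col c u w' →
                                col c v₀ u ≡ c₃ ⊎ col c v₀ u ≡ c₀
    spoke-between-fresh-edges u-out w-out w'-out u≢w u≢w' α-fresh α'-fresh α≢α'
      with spoke-to-fresh-edge u-out w-out u≢w α-fresh | spoke-to-fresh-edge u-out w'-out u≢w' α'-fresh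
    ... | here e         | _              = inj₁ e
    ... | there (here e) | _              = inj₂ e
    ... | _              | here e         = inj₁ e
    ... | _              | there (here e) = inj₂ e
    ... | there (there (here e)) | there (there (here e')) = ⊥-elim (α≢α' (trans (sym e) e'))

    fresh-edges-joined-by-c₂ : ∀ {u₁ w₁ u₂ w₂} → Off u₁ → Off w₁ → Off u₂ → Off w₂ →
                               u₁ ≢ w₁ → u₁ ≢ u₂ → u₁ ≢ w₂ → w₁ ≢ u₂ → w₁ ≢ w₂ → u₂ ≢ w₂ →
                               Fresh Z (col c u₁ w₁) → Fresh Z (col c u₂ w₂) → col c u₁ w₁ ≢ col c u₂ w₂ →
                               col c u₁ u₂ ≡ c₂ → ⊥
    fresh-edges-joined-by-c₂ out-u₁ out-w₁ out-u₂ out-w₂ u₁≢w₁ u₁≢u₂ u₁≢w₂ w₁≢u₂ w₁≢w₂ u₂≢w₂ fresh₁ fresh₂ α₁≢α₂ γ≡c₂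
      with spoke-to-fresh-edge out-u₁ out-w₁ u₁≢w₁ fresh₁
    ... | here e =
      branch-off-along-v₁ out-u₁ out-u₂ out-w₁ u₁≢u₂ u₁≢w₂ u₁≢w₁ (out-w₂ _) (out-w₂ _) u₂≢w₂ (≢-sym w₁≢u₂) (≢-sym w₁≢w₂)
        (col-swap c e) γ≡c₂ refl refl
        ((c₃≢c₀ ∷ ≢-sym c₂≢c₃ ∷ ≢-sym (fresh₂ (# 3)) ∷ ≢-sym (fresh₁ (# 3)) ∷ []) ∷
         (c₀≢c₂ ∷ ≢-sym (fresh₂ (# 0)) ∷ ≢-sym (fresh₁ (# 0)) ∷ []) ∷
         (≢-sym (fresh₂ (# 2)) ∷ ≢-sym (fresh₁ (# 2)) ∷ []) ∷
         (≢-sym α₁≢α₂ ∷ []) ∷ [] ∷ [])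
    ... | there (here e) =
      branch-off-along-v₃ out-u₁ out-u₂ out-w₁ u₁≢u₂ u₁≢w₂ u₁≢w₁ (out-w₂ _) (out-w₂ _) u₂≢w₂ (≢-sym w₁≢u₂) (≢-sym w₁≢w₂)
        (col-swap c e) γ≡c₂ refl refl
        ((≢-sym c₃≢c₀ ∷ c₀≢c₂ ∷ ≢-sym (fresh₂ (# 0)) ∷ ≢-sym (fresh₁ (# 0)) ∷ []) ∷
         (≢-sym c₂≢c₃ ∷ ≢-sym (fresh₂ (# 3)) ∷ ≢-sym (fresh₁ (# 3)) ∷ []) ∷
         (≢-sym (fresh₂ (# 2)) ∷ ≢-sym (fresh₁ (# 2)) ∷ []) ∷
         (≢-sym α₁≢α₂ ∷ []) ∷ [] ∷ [])
    ... | there (there (here e)) =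
      branch-v₀-along-v₁ out-u₁ out-u₂ u₁≢u₂ (≢-sym v₃≢v₀) v₁≢v₃ v₂≢v₃ (≢-sym (out-u₁ _)) (≢-sym (out-u₂ _))
        e γ≡c₂ (col-sym c _ _)
        ((fresh₁ (# 2) ∷ fresh₁ (# 0) ∷ fresh₁ (# 1) ∷ fresh₁ (# 3) ∷ []) ∷
         (≢-sym c₀≢c₂ ∷ ≢-sym c₁≢c₂ ∷ c₂≢c₃ ∷ []) ∷
         (c₀≢c₁ ∷ ≢-sym c₃≢c₀ ∷ []) ∷
         (c₁≢c₃ ∷ []) ∷ [] ∷ [])

    far-spoke-of-fresh-pair : ∀ {u w w'} → Off u → Off w → Off w' → u ≢ w → u ≢ w' →
                              Fresh Z (col c u w) → Fresh Z (col c u w') → col c u w ≢ col c u w' →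
                              col c v₂ w ≢ c₀ → col c v₂ w ≢ c₃ → col c v₂ w ≢ col c u w → col c v₂ w ≢ col c u w' → ⊥
    far-spoke-of-fresh-pair u-out w-out w'-out u≢w u≢w' α-fresh α'-fresh α≢α' y≢c₀ y≢c₃ y≢α y≢α'
      with spoke-between-fresh-edges u-out w-out w'-out u≢w u≢w' α-fresh α'-fresh α≢α'
    ... | inj₁ e =
      branch-off-along-v₁ u-out w-out w'-out u≢w (≢-sym (u-out _)) u≢w' v₀≢v₂ v₁≢v₂ (≢-sym (w-out _))
        (α≢α' ∘ cong (col c _)) (w'-out _) (col-swap c e) refl (col-sym c _ _) refl
        ((c₃≢c₀ ∷ ≢-sym (α-fresh (# 3)) ∷ ≢-sym y≢c₃ ∷ ≢-sym (α'-fresh (# 3)) ∷ []) ∷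
         (≢-sym (α-fresh (# 0)) ∷ ≢-sym y≢c₀ ∷ ≢-sym (α'-fresh (# 0)) ∷ []) ∷
         (≢-sym y≢α ∷ α≢α' ∷ []) ∷
         (y≢α' ∷ []) ∷ [] ∷ [])
    ... | inj₂ e =
      branch-off-along-v₃ u-out w-out w'-out u≢w (≢-sym (u-out _)) u≢w' v₀≢v₂ (≢-sym v₂≢v₃) (≢-sym (w-out _))
        (α≢α' ∘ cong (col c _)) (w'-out _) (col-swap c e) refl (col-sym c _ _) refl
        ((≢-sym c₃≢c₀ ∷ ≢-sym (α-fresh (# 0)) ∷ ≢-sym y≢c₀ ∷ ≢-sym (α'-fresh (# 0)) ∷ []) ∷
         (≢-sym (α-fresh (# 3)) ∷ ≢-sym y≢c₃ ∷ ≢-sym (α'-fresh (# 3)) ∷ []) ∷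
         (≢-sym y≢α ∷ α≢α' ∷ []) ∷
         (y≢α' ∷ []) ∷ [] ∷ [])

    spoke-coloured-like-fresh-edge : ∀ {u w w'} → Off u → Off w → Off w' → u ≢ w → u ≢ w' →
                                     Fresh Z (col c u w) → Fresh Z (col c u w') → col c u w ≢ col c u w' →
                                     col c v₀ w ≡ col c u w → ⊥
    spoke-coloured-like-fresh-edge u-out w-out w'-out u≢w u≢w' α-fresh α'-fresh α≢α' v₀w≡α
      with spoke-between-fresh-edges u-out w-out w'-out u≢w u≢w' α-fresh α'-fresh α≢α'
    ... | inj₁ e =
      branch-v₀-along-v₁ u-out w'-out u≢w' (w-out _) (w-out _) (w-out _) u≢w (≢-sym (α≢α' ∘ cong (col c _)))
        e refl v₀w≡α
        ((≢-sym (α'-fresh (# 3)) ∷ c₃≢c₀ ∷ ≢-sym c₁≢c₃ ∷ ≢-sym (α-fresh (# 3)) ∷ []) ∷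
         (α'-fresh (# 0) ∷ α'-fresh (# 1) ∷ ≢-sym α≢α' ∷ []) ∷
         (c₀≢c₁ ∷ ≢-sym (α-fresh (# 0)) ∷ []) ∷
         (≢-sym (α-fresh (# 1)) ∷ []) ∷ [] ∷ [])
    ... | inj₂ e =
      branch-v₀-along-v₃ u-out w'-out u≢w' (w-out _) (w-out _) (w-out _) u≢w (≢-sym (α≢α' ∘ cong (col c _)))
        e refl v₀w≡α
        ((≢-sym (α'-fresh (# 0)) ∷ ≢-sym c₃≢c₀ ∷ c₀≢c₂ ∷ ≢-sym (α-fresh (# 0)) ∷ []) ∷
         (α'-fresh (# 3) ∷ α'-fresh (# 2) ∷ ≢-sym α≢α' ∷ []) ∷
         (≢-sym c₂≢c₃ ∷ ≢-sym (α-fresh (# 3)) ∷ []) ∷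
         (≢-sym (α-fresh (# 2)) ∷ []) ∷ [] ∷ [])

  module FreshEdges (S221-free : RainbowFree S221 c) (Z : RainbowSquare) where
    open SquareFacts S221-free Z
    private module Opposite = SquareFacts S221-free (rotate-by 2 Z)

    fresh-edges-at : ∀ {u w w'} → Off u → Off w → Off w' → u ≢ w → u ≢ w' →
                     Fresh Z (col c u w) → Fresh Z (col c u w') → col c u w ≡ col c u w'
    fresh-edges-at {u} {w} {w'} u-out w-out w'-out u≢w u≢w' α-fresh α'-fresh with col c u w Data.Nat.≟ col c u w'
    ... | yes α≡α' = α≡α'
    ... | no α≢α'
      with Opposite.spoke-to-fresh-edge (rotate-by-outside 2 Z w-out) (rotate-by-outside 2 Z u-out) (≢-sym u≢w)
                                        (rotate-by-fresh 2 Z (fresh-swap Z α-fresh))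
    ...   | here y≡c₁ = ⊥-elim (far-spoke-of-fresh-pair u-out w-out w'-out u≢w u≢w' α-fresh α'-fresh α≢α'
              (λ y≡c₀ → c₀≢c₁ (trans (sym y≡c₀) y≡c₁)) (λ y≡c₃ → c₁≢c₃ (trans (sym y≡c₁) y≡c₃))
              (λ y≡α → α-fresh (# 1) (trans (sym y≡α) y≡c₁)) (λ y≡α' → α'-fresh (# 1) (trans (sym y≡α') y≡c₁)))
    ...   | there (here y≡c₂) = ⊥-elim (far-spoke-of-fresh-pair u-out w-out w'-out u≢w u≢w' α-fresh α'-fresh α≢α'
              (λ y≡c₀ → c₀≢c₂ (trans (sym y≡c₀) y≡c₂)) (λ y≡c₃ → c₂≢c₃ (trans (sym y≡c₂) y≡c₃))
              (λ y≡α → α-fresh (# 2) (trans (sym y≡α) y≡c₂)) (λ y≡α' → α'-fresh (# 2) (trans (sym y≡α') y≡c₂)))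
    ...   | there (there (here y≡α)) = ⊥-elim (Opposite.spoke-coloured-like-fresh-edge
              (rotate-by-outside 2 Z u-out) (rotate-by-outside 2 Z w-out) (rotate-by-outside 2 Z w'-out) u≢w u≢w'
              (rotate-by-fresh 2 Z α-fresh) (rotate-by-fresh 2 Z α'-fresh) α≢α' (trans y≡α (col-sym c w u)))

    shift : Fin 4 → ℕ
    shift zero                   = 2
    shift (suc zero)             = 3
    shift (suc (suc zero))       = 0
    shift (suc (suc (suc zero))) = 1

    side-after-shift : ∀ i → side (rotate-by (shift i) Z) (# 2) ≡ side Z i
    side-after-shift zero                   = refl
    side-after-shift (suc zero)             = refl
    side-after-shift (suc (suc zero))       = refl
    side-after-shift (suc (suc (suc zero))) = refl

    disjoint-fresh-edges : ∀ {u₁ w₁ u₂ w₂} → Off u₁ → Off w₁ → Off u₂ → Off w₂ →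
                           u₁ ≢ w₁ → u₁ ≢ u₂ → u₁ ≢ w₂ → w₁ ≢ u₂ → w₁ ≢ w₂ → u₂ ≢ w₂ →
                           Fresh Z (col c u₁ w₁) → Fresh Z (col c u₂ w₂) → col c u₁ w₁ ≡ col c u₂ w₂
    disjoint-fresh-edges {u₁} {w₁} {u₂} {w₂} o-u₁ o-w₁ o-u₂ o-w₂ u₁≢w₁ u₁≢u₂ u₁≢w₂ w₁≢u₂ w₁≢w₂ u₂≢w₂ fresh₁ fresh₂
      with col c u₁ w₁ Data.Nat.≟ col c u₂ w₂
    ... | yes α₁≡α₂ = α₁≡α₂
    ... | no α₁≢α₂ with any? (λ i → col c u₁ u₂ Data.Nat.≟ side Z i)
    ...   | yes (i , γ≡cᵢ) = ⊥-elim (SquareFacts.fresh-edges-joined-by-c₂ S221-free (rotate-by (shift i) Z)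
              (rotate-by-outside (shift i) Z o-u₁) (rotate-by-outside (shift i) Z o-w₁)
              (rotate-by-outside (shift i) Z o-u₂) (rotate-by-outside (shift i) Z o-w₂)
              u₁≢w₁ u₁≢u₂ u₁≢w₂ w₁≢u₂ w₁≢w₂ u₂≢w₂
              (rotate-by-fresh (shift i) Z fresh₁) (rotate-by-fresh (shift i) Z fresh₂) α₁≢α₂
              (trans γ≡cᵢ (sym (side-after-shift i))))
    ...   | no γ-no-side with col c u₁ u₂ Data.Nat.≟ col c u₁ w₁
    ...     | yes γ≡α₁ = ⊥-elim (α₁≢α₂ (sym (begin
              col c u₂ w₂ ≡⟨ fresh-edges-at o-u₂ o-w₂ o-u₁ u₂≢w₂ (≢-sym u₁≢u₂) fresh₂ (fresh-swap Z γ-fresh) ⟩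
              col c u₂ u₁ ≡⟨ col-sym c u₂ u₁ ⟩
              col c u₁ u₂ ≡⟨ γ≡α₁ ⟩
              col c u₁ w₁ ∎)))
      where
      open ≡-Reasoning
      γ-fresh : Fresh Z (col c u₁ u₂)
      γ-fresh i = γ-no-side ∘ (i ,_)
    ...     | no γ≢α₁ = ⊥-elim (γ≢α₁ (sym (fresh-edges-at o-u₁ o-w₁ o-u₂ u₁≢w₁ u₁≢u₂ fresh₁ γ-fresh)))
      where
      γ-fresh : Fresh Z (col c u₁ u₂)
      γ-fresh i = γ-no-side ∘ (i ,_)

    fresh-outer-edges : ∀ {u w p q} → Off u → Off w → Off p → Off q → u ≢ w → p ≢ q →
                        Fresh Z (col c u w) → Fresh Z (col c p q) → col c u w ≡ col c p q
    fresh-outer-edges {u} {w} {p} {q} o-u o-w o-p o-q u≢w p≢q α-fresh β-fresh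
      with p Fin.≟ u | p Fin.≟ w | q Fin.≟ u | q Fin.≟ w
    ... | yes refl | _        | _        | _        = fresh-edges-at o-u o-w o-q u≢w p≢q α-fresh β-fresh
    ... | no _     | yes refl | _        | _        =
      trans (col-sym c u w) (fresh-edges-at o-w o-u o-q (≢-sym u≢w) p≢q (fresh-swap Z α-fresh) β-fresh)
    ... | no p≢u   | no _     | yes refl | _        =
      trans (fresh-edges-at o-u o-w o-p u≢w (≢-sym p≢u) α-fresh (fresh-swap Z β-fresh)) (col-sym c u p)
    ... | no _     | no p≢w   | no _     | yes refl =
      trans (col-sym c u w)
        (trans (fresh-edges-at o-w o-u o-p (≢-sym u≢w) (≢-sym p≢w) (fresh-swap Z α-fresh) (fresh-swap Z β-fresh))
               (col-sym c w p))
    ... | no p≢u   | no p≢w   | no q≢u   | no q≢w   =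
      disjoint-fresh-edges o-u o-w o-p o-q u≢w (≢-sym p≢u) (≢-sym q≢u) (≢-sym p≢w) (≢-sym q≢w) p≢q α-fresh β-fresh

module SmallCycle {n} (c : Coloring n) (S221-free : RainbowFree S221 c)
                  (f : Fin 4 → Fin n) (f-injective : Injective _≡_ _≡_ f)
                  (f-rainbow : Unique (imageColors (Cycle 4) c f)) where
  open Squares c
  open import Data.List.Membership.DecPropositional Data.Nat._≟_ using (_∉?_)

  side-injective : ∀ {i j} → col c (f i) (f (next i)) ≡ col c (f j) (f (next j)) → i ≡ j
  side-injective = cong proj₁ ∘
    unique-map-injective (λ e → col c (f (proj₁ e)) (f (proj₂ e))) f-rainbow (side-edge _) (side-edge _)

  Z : RainbowSquare
  Z = record
    { vertex        = f
    ; vertex-apart₁ = λ i → next-apart₁ i ∘ f-injective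
    ; vertex-apart₂ = λ i → next-apart₂ i ∘ f-injective
    ; side-apart₁   = λ i → next-apart₁ i ∘ side-injective
    ; side-apart₂   = λ i → next-apart₂ i ∘ side-injective
    }

  Y : List ℕ
  Y = innerColours c f

  fresh : ∀ {x} → x ∉ Y → Fresh Z x
  fresh x∉Y i = ∉-innerColours c f x∉Y i (next i)

  freshSpokeColours : Fin 4 → List ℕ
  freshSpokeColours i = deduplicate Data.Nat._≟_ (filter (_∉? Y) (map (col c (f i)) (allFin n)))

  ∈-freshSpokeColours⁺ : ∀ i {q} → col c (f i) q ∉ Y → col c (f i) q ∈ freshSpokeColours i
  ∈-freshSpokeColours⁺ i {q} x∉Y = ∈-deduplicate⁺ Data.Nat._≟_ (∈-filter⁺ (_∉? Y) (∈-map⁺ (col c (f i)) (∈-allFin q)) x∉Y)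

  ∈-freshSpokeColours⁻ : ∀ i {x} → x ∈ freshSpokeColours i → x ∉ Y × ∃ λ q → Outside f q × col c (f i) q ≡ x
  ∈-freshSpokeColours⁻ i x∈ with ∈-filter⁻ (_∉? Y) {xs = map (col c (f i)) (allFin n)} (∈-deduplicate⁻ Data.Nat._≟_ _ x∈)
  ... | x∈map , x∉Y with ∈-map⁻ (col c (f i)) x∈map
  ...   | q , _ , refl = x∉Y , q , (λ j fj≡q → x∉Y (subst (λ v → col c (f i) v ∈ Y) fj≡q (∈-innerColours c f i j))) , refl

  corner : ∀ i → vertex (rotate-by (toℕ i) Z) (# 0) ≡ f i
  corner zero                   = refl
  corner (suc zero)             = refl
  corner (suc (suc zero))       = refl
  corner (suc (suc (suc zero))) = refl

  length-freshSpokeColours : ∀ i → length (freshSpokeColours i) ≤ 2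
  length-freshSpokeColours i = SquareFacts.fresh-spoke-colours S221-free (rotate-by (toℕ i) Z) (freshSpokeColours i)
                            (deduplicate-! Data.Nat._≟_ _) spoke
    where
    spoke : ∀ {x} → x ∈ freshSpokeColours i → Fresh (rotate-by (toℕ i) Z) x ×
            ∃ λ q → Outside (vertex (rotate-by (toℕ i) Z)) q × col c (vertex (rotate-by (toℕ i) Z) (# 0)) q ≡ x
    spoke x∈ with ∈-freshSpokeColours⁻ i x∈
    ... | x∉Y , q , q-out , iq≡x = rotate-by-fresh (toℕ i) Z (fresh x∉Y) , q , rotate-by-outside (toℕ i) Z q-out ,
                                   subst (λ v → col c v q ≡ _) (sym (corner i)) iq≡x

  knownColours : List ℕ
  knownColours = Y ++ concatMap freshSpokeColours (allFin 4)

  length-knownColours : length knownColours ≤ 24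
  length-knownColours = ≤-trans (≤-reflexive (length-++ Y {concatMap freshSpokeColours (allFin 4)}))
                         (+-mono-≤ (length-innerColours c f)
                                   (length-concatMap-≤ freshSpokeColours length-freshSpokeColours (allFin 4)))

  unknown-colour-site : ∀ {x} → UsedColor c x → x ∉ knownColours →
                        ∃₂ λ u w → Outside f u × Outside f w × u ≢ w × Fresh Z x × col c u w ≡ x
  unknown-colour-site used x∉known with new-colour-site c f used (x∉known ∘ ∈-++⁺ˡ)
  ... | inj₁ (i , q , _ , refl) =
    ⊥-elim (x∉known (∈-++⁺ʳ Y (∈-concatMap⁺ freshSpokeColours
      (lose (∈-allFin i) (∈-freshSpokeColours⁺ i (x∉known ∘ ∈-++⁺ˡ))))))
  ... | inj₂ (u , w , u-out , w-out , u≢w , refl) = u , w , u-out , w-out , u≢w , fresh (x∉known ∘ ∈-++⁺ˡ) , refl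

  at-most-one-unknown : AtMostOneColourOutside c knownColours
  at-most-one-unknown used-x used-y x∉known y∉known
    with unknown-colour-site used-x x∉known | unknown-colour-site used-y y∉known
  ... | u , w , u-out , w-out , u≢w , x-fresh , refl | p , q , p-out , q-out , p≢q , y-fresh , refl =
    FreshEdges.fresh-outer-edges S221-free Z u-out w-out p-out q-out u≢w p≢q x-fresh y-fresh

rainbow-cycle-colours : ∀ {n} (c : Coloring n) → RainbowFree S221 c → ∀ k → 4 ≤ k → HasRainbow (Cycle k) c →
                        ∃ λ L → 2 + length L ≤ 10 + k * k × AtMostOneColourOutside c L
rainbow-cycle-colours c S221-free 4 (s≤s (s≤s (s≤s (s≤s _)))) (f , f-injective , f-rainbow) =
  knownColours , s≤s (s≤s length-knownColours) , at-most-one-unknown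
  where open SmallCycle c S221-free f f-injective f-rainbow
rainbow-cycle-colours c S221-free (suc (suc (suc (suc (suc m))))) (s≤s (s≤s (s≤s (s≤s _)))) (f , f-injective , f-rainbow) =
  Y , +-mono-≤ (s≤s (s≤s (z≤n {8}))) (length-innerColours c f) ,
  λ used-x _ x∉Y _ → ⊥-elim (x∉Y (used-colours-inner used-x))
  where open LongCycle c S221-free m f f-injective f-rainbow

theorem11 : ∀ (k : ℕ) → 4 ≤ k → S221 ≼ Cycle k
theorem11 k 4≤k = 10 + k * k , s≤s z≤n , λ n c many S221-free rainbow-cycle →
  let L , bound , at-most-one = rainbow-cycle-colours c S221-free k 4≤k rainbow-cycle
  in two-colours-outside {c = c} {L = L} many bound at-most-one
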